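{- For each $\mathcal{C}\in\{\mathrm{Horn},\mathrm{dHorn},\mathrm{Krom}\}$, the parameters $\mathrm{depth}_{\mathcal{C}}$ and $\mathrm{bdtw}_{\mathcal{C}}$ are domination orthogonal.
   Context: A clause is a finite set of literals with no complementary pair; a CNF formula is a finite set of clauses. For a partial assignment $\tau$, $F[\tau]$ is obtained by deleting clauses containing a true literal and deleting false literals from the remaining clauses. The incidence graph $G_F$ is the bipartite graph between variables and clauses ($x$ adjacent to $c$ iff $x$ or $\neg x$ is in $c$); $\mathrm{Conn}(F)$ is the set of connected components. Horn: every clause has at most one positive literal; dHorn: at most one negative literal; Krom: at most two literals. $\mathrm{depth}_{\mathcal{C}}(F)$ is $0$ if $F\in\mathcal{C}$; if $F\notin\mathcal{C}$ and $F$ is connected it is $1+\min_{x\in\mathit{var}(F)}\max_{\epsilon\in\{0,1\}}\mathrm{depth}_{\mathcal{C}}(F[x=\epsilon])$; otherwise it is $\max_{F'\in\mathrm{Conn}(F)}\mathrm{depth}_{\mathcal{C}}(F')$. A $\mathcal{C}$-backdoor of $F$ is a set $X\subseteq\mathit{var}(F)$ with $F[\tau]\in\mathcal{C}$ for all $\tau:X\to\{0,1\}$. The torso graph of $F$ with respect to $X$ has vertex set $X$ and an edge $\{x,y\}$ iff $x,y$ occur together in some clause of $F$, or there is a connected component of $G_F-X$ in which both $x$ and $y$ have a neighbour. The $\mathcal{C}$-backdoor treewidth $\mathrm{bdtw}_{\mathcal{C}}(F)$ is the minimum treewidth of the torso graph over all $\mathcal{C}$-backdoors $X$ of $F$. For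 integer-valued parameters $p,q$: $p$ dominates $q$ if every class of formulas on which $q$ is bounded also has $p$ bounded; $p$ and $q$ are domination orthogonal if neither dominates the other. -}

module Defs where

open import Data.Nat using (ℕ; zero; suc; _≤_)
open import Data.Bool using (Bool; true; false; not)
open import Data.Fin using (Fin; toℕ)
import Data.Fin as Fin
open import Data.Product using (Σ; ∃; _×_; _,_)
open import Data.Product.Properties using (≡-dec)
open import Data.Sum using (_⊎_)
open import Data.List using (List; []; _∷_; map; filter; foldr; length)
open import Data.List.Membership.Propositional using (_∈_)
import Data.List.Membership.DecPropositional as DecMem
open import Relation.Binary.PropositionalEquality using (_≡_; _≢_)
open import Relation.Binary.Construct.Closure.ReflexiveTransitive using (Star)
open import Relation.Nullary using (¬_; ¬?)
open import Relation.Binary using (DecidableEquality)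
import Data.Nat as ℕ
import Data.Bool as 𝔹

-- Variables are natural numbers.  A literal (x , true) is x, (x , false) is ¬x.
Var : Set
Var = ℕ

Lit : Set
Lit = Var × Bool

_≟L_ : DecidableEquality Lit
_≟L_ = ≡-dec ℕ._≟_ 𝔹._≟_

open DecMem _≟L_ using () renaming (_∈?_ to _∈L?_)

-- A clause is a finite set of literals, represented by a list
-- (all notions below only depend on list membership).
Clause : Set
Clause = List Lit

Formula : Set
Formula = List Clause

NoCompl : Clause → Set
NoCompl c = ∀ x → (x , true) ∈ c → (x , false) ∈ c → Data.Empty.⊥
  where import Data.Empty

WF : Formula → Set
WF F = ∀ c → c ∈ F → NoCompl c

_∈vc_ : Var → Clause → Set
x ∈vc c = ∃ λ b → (x , b) ∈ c

_∈var_ : Var → Formula → Set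
x ∈var F = ∃ λ c → c ∈ F × x ∈vc c

removeLit : Lit → Clause → Clause
removeLit l c = filter (λ l' → ¬? (l' ≟L l)) c

restrict : Var → Bool → Formula → Formula
restrict x ε F = map (removeLit (x , not ε)) (filter (λ c → ¬? ((x , ε) ∈L? c)) F)

-- F[τ] for τ : X → {0,1}, with τ given as a function on all variables
-- of which only the values on X are used.
restrictAll : List Var → (Var → Bool) → Formula → Formula
restrictAll X τ F = foldr (λ x G → restrict x (τ x) G) F X

data BaseClass : Set where
  Horn dHorn Krom : BaseClass

ClauseIn : BaseClass → Clause → Set
ClauseIn Horn  c = ∀ x y → (x , true) ∈ c → (y , true) ∈ c → x ≡ y
ClauseIn dHorn c = ∀ x y → (x , false) ∈ c → (y , false) ∈ c → x ≡ y
ClauseIn Krom  c = ∀ l₁ l₂ l₃ → l₁ ∈ c → l₂ ∈ c → l₃ ∈ c →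
                   l₁ ≡ l₂ ⊎ l₁ ≡ l₃ ⊎ l₂ ≡ l₃

InClass : BaseClass → Formula → Set
InClass 𝒞 F = ∀ c → c ∈ F → ClauseIn 𝒞 c

-- Clauses c, d of F are adjacent in G_F - X (via a common variable z
-- with Allowed z); the reflexive-transitive closure gives connectivity
-- of clause vertices in the incidence graph with the non-allowed
-- variables removed.
ClauseStep : (Var → Set) → Formula → Clause → Clause → Set
ClauseStep Allowed F c d = c ∈ F × d ∈ F × ∃ λ z → Allowed z × z ∈vc c × z ∈vc d

AllVars : Var → Set
AllVars _ = Data.Unit.⊤
  where import Data.Unit

-- F' is (a list representing) a connected component of F, i.e. the set of
-- clauses of F connected to some clause c ∈ F in G_F.
-- (Variables of F all lie in clauses, so components are determined by
-- their clause sets.)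
IsComponent : Formula → Formula → Set
IsComponent F F' = Σ Clause λ c → c ∈ F ×
  (∀ d → (d ∈ F' → d ∈ F × Star (ClauseStep AllVars F) c d)
       × (d ∈ F × Star (ClauseStep AllVars F) c d → d ∈ F'))

-- Unfolding of the recursive definition: depth_𝒞(F) ≤ k iff every
-- connected component F' of F is in 𝒞, or (k = suc k') and some
-- variable x of F' has depth_𝒞(F'[x=ε]) ≤ k' for both ε.

DepthLe : BaseClass → Formula → ℕ → Set
DepthLe 𝒞 F zero    = InClass 𝒞 F
DepthLe 𝒞 F (suc k) = ∀ F' → IsComponent F F' →
  InClass 𝒞 F' ⊎ (∃ λ x → x ∈var F' × (∀ ε → DepthLe 𝒞 (restrict x ε F') k))

IsBackdoor : BaseClass → Formula → List Var → Set
IsBackdoor 𝒞 F X = (∀ x → x ∈ X → x ∈var F) × (∀ τ → InClass 𝒞 (restrictAll X τ F))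

NotIn : List Var → Var → Set
NotIn X z = ¬ (z ∈ X)

TorsoEdge : Formula → List Var → Var → Var → Set
TorsoEdge F X x y =
  x ∈ X × y ∈ X × x ≢ y ×
  ( (∃ λ c → c ∈ F × x ∈vc c × y ∈vc c)
  ⊎ (∃ λ c → ∃ λ d → c ∈ F × d ∈ F × x ∈vc c × y ∈vc d ×
        Star (ClauseStep (NotIn X) F) c d) )
  -- second disjunct: some component of G_F - X contains a neighbour
  -- (necessarily a clause) of x and a neighbour of y.

-- A finite tree with nodes Fin (suc m): node suc i has parent par i,
-- where par i has smaller index (every finite tree arises this way).
record TreeDecomposition (V : List Var) (E : Var → Var → Set) : Set where
  field
    m      : ℕ
    par    : Fin m → Fin (suc m)
    par<   : ∀ i → toℕ (par i) ≤ toℕ i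
    bag    : Fin (suc m) → List Var
    cover  : ∀ v → v ∈ V → ∃ λ t → v ∈ bag t
    edges  : ∀ u v → u ∈ V → v ∈ V → E u v → ∃ λ t → u ∈ bag t × v ∈ bag t
    connected : ∀ v s t → v ∈ bag s → v ∈ bag t →
      Star (λ a b → v ∈ bag a × v ∈ bag b ×
                    ((∃ λ i → a ≡ Fin.suc i × b ≡ par i) ⊎
                     (∃ λ i → b ≡ Fin.suc i × a ≡ par i))) s t

  WidthLe : ℕ → Set
  WidthLe k = ∀ t → length (bag t) ≤ suc k

TreewidthLe : (V : List Var) → (Var → Var → Set) → ℕ → Set
TreewidthLe V E k = Σ (TreeDecomposition V E) λ T → TreeDecomposition.WidthLe T k

BdtwLe : BaseClass → Formula → ℕ → Set
BdtwLe 𝒞 F k = ∃ λ X → IsBackdoor 𝒞 F X × TreewidthLe X (TorsoEdge F X) k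

-- A parameter is given by the relation "p(F) ≤ k".
Parameter : Set₁
Parameter = Formula → ℕ → Set

Bounded : Parameter → (Formula → Set) → Set
Bounded p 𝒦 = ∃ λ k → ∀ F → 𝒦 F → p F k

Dominates : Parameter → Parameter → Set₁
Dominates p q = ∀ (𝒦 : Formula → Set) → (∀ F → 𝒦 F → WF F) →
  Bounded q 𝒦 → Bounded p 𝒦

DominationOrthogonal : Parameter → Parameter → Set₁
DominationOrthogonal p q = (¬ Dominates p q) × (¬ Dominates q p)

-- Write ℓ for the polarity the class restricts (`limited 𝒞` below).
--
-- The path formulas with clauses {x_i, x_{i+1}, x_{i+2}}, all literals of polarity ℓ, have all
-- their variables as a backdoor, and the torso is covered by the bags {x_i, x_{i+1}, x_{i+2}}
-- of a path decomposition of width 2. Their depth is unbounded: a variable meets at most three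
-- consecutive clauses, so after assigning it one half of any window of consecutive clauses
-- remains inside a single component, and a window of length 2L + 3 forces one more level.
--
-- The gadget formulas have a hub variable h, gadget clauses {h} ∪ G_i where the ℓ-literals G_i
-- alone already violate the class, and link clauses {h, u, v} of polarity ¬ℓ for all gadget
-- variables u, v. Setting h to ℓ leaves two-literal link clauses, setting it to ¬ℓ leaves the
-- gadgets as separate components, each repaired by one further variable: depth ≤ 2. But a
-- backdoor must meet every gadget, and the link clauses turn the meeting points into a clique
-- of the torso, so k + 2 gadgets force treewidth above k.

module Submission where

open import Defs
open import Data.Bool using (Bool; true; false; not)
import Data.Bool as 𝔹
open import Data.Bool.Properties using (¬-not; not-¬; not-involutive)
open import Data.Empty using (⊥-elim)
open import Data.Fin using (Fin; toℕ; inject₁; fromℕ<)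
import Data.Fin as Fin
open import Data.Fin.Properties using (toℕ-inject₁; toℕ-injective; toℕ-fromℕ<)
open import Data.List using (List; []; _∷_; _++_; map; filter; length; upTo; allFin; concatMap; cartesianProduct)
open import Data.List.Extrema.Nat using (argmin; argmin-sel; f[argmin]≤f[⊤]; f[argmin]≤f[xs]; argmax; argmax-sel; f[⊥]≤f[argmax]; f[xs]≤f[argmax])
open import Data.List.Membership.Propositional using (_∈_; _∉_; find; lose)
open import Data.List.Membership.Propositional.Properties
import Data.List.Membership.DecPropositional as DecMem
open import Data.List.Properties using (length-++-sucʳ; filter-all)
open import Data.List.Relation.Binary.Subset.Propositional using (_⊆_)
open import Data.List.Relation.Unary.All using (All; lookup)
import Data.List.Relation.Unary.All as All
open import Data.List.Relation.Unary.AllPairs using ([]; _∷_)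
open import Data.List.Relation.Unary.Any using (here; there; any?)
open import Data.List.Relation.Unary.Unique.Propositional using (Unique)
open import Data.Nat using (ℕ; zero; suc; _≤_; _<_; _+_; _∸_; z≤n; s≤s; s≤s⁻¹; z<s; s<s; _<?_)
import Data.Nat as ℕ
open import Data.Nat.Properties
open import Data.Product using (∃; ∃₂; _×_; _,_; proj₁; proj₂; uncurry)
open import Data.Sum using (_⊎_; inj₁; inj₂)
open import Data.Unit using (tt)
open import Effect.Monad using (RawMonad)
open import Function using (_∘_; id; case_of_)
open import Level using (0ℓ)
open import Relation.Binary.Construct.Closure.ReflexiveTransitive using (Star; ε; _◅_; _◅◅_; reverse)
open import Relation.Binary.PropositionalEquality
open import Relation.Nullary using (¬_; Dec; yes; no; ¬?)
open import Relation.Nullary.Decidable using (¬¬-excluded-middle)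
open import Relation.Nullary.Negation using (DoubleNegation; ¬¬-Monad; ¬¬-map)

open DecMem ℕ._≟_ using () renaming (_∈?_ to _∈ℕ?_)
open DecMem _≟L_ using () renaming (_∈?_ to _∈L?_)
open RawMonad (¬¬-Monad {0ℓ}) using (pure; _>>=_)

TreeLink : ∀ {m} → (Fin m → Fin (suc m)) → (Fin (suc m) → List Var) →
           Var → Fin (suc m) → Fin (suc m) → Set
TreeLink par bag v a b = v ∈ bag a × v ∈ bag b ×
  ((∃ λ i → a ≡ Fin.suc i × b ≡ par i) ⊎ (∃ λ i → b ≡ Fin.suc i × a ≡ par i))

TreeLink-sym : ∀ {m par bag v} {a b : Fin (suc m)} →
               TreeLink par bag v a b → TreeLink par bag v b a
TreeLink-sym (va , vb , inj₁ up)   = vb , va , inj₂ up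
TreeLink-sym (va , vb , inj₂ down) = vb , va , inj₁ down

module TreeDecompositionProperties {V : List Var} {E : Var → Var → Set}
                                   (T : TreeDecomposition V E) where
  open TreeDecomposition T

  Node : Set
  Node = Fin (suc m)

  data Ancestor (a : Node) : Node → Set where
    here  : Ancestor a a
    child : ∀ i → Ancestor a (par i) → Ancestor a (Fin.suc i)

  Ancestor⇒≤ : ∀ {a b} → Ancestor a b → toℕ a ≤ toℕ b
  Ancestor⇒≤ here        = ≤-refl
  Ancestor⇒≤ (child i p) = ≤-trans (Ancestor⇒≤ p) (≤-trans (par< i) (n≤1+n _))

  Ancestor-≥⇒≡ : ∀ {a b} → Ancestor a b → toℕ b ≤ toℕ a → a ≡ b
  Ancestor-≥⇒≡ here        _ = refl
  Ancestor-≥⇒≡ (child i p) q = ⊥-elim (<⇒≱ (s≤s (≤-trans (Ancestor⇒≤ p) (par< i))) q)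

  Ancestor-trans : ∀ {a b c} → Ancestor a b → Ancestor b c → Ancestor a c
  Ancestor-trans p here        = p
  Ancestor-trans p (child i q) = child i (Ancestor-trans p q)

  Walk : Var → Node → Node → Set
  Walk v = Star (TreeLink par bag v)

  walk-commonAncestor : ∀ {v s t} → Walk v s t → v ∈ bag s →
                        ∃ λ r → v ∈ bag r × Ancestor r s × Ancestor r t
  walk-commonAncestor {s = s} ε vs = s , vs , here , here
  walk-commonAncestor (link ◅ walk) vs
    with walk-commonAncestor walk (proj₁ (proj₂ link)) | proj₂ (proj₂ link)
  ... | r , vr , r≼s' , r≼t | inj₁ (i , refl , refl) = r , vr , child i r≼s' , r≼t
  ... | r , vr , here , r≼t | inj₂ (i , refl , refl) =
    par i , vs , here , Ancestor-trans (child i here) r≼t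
  ... | r , vr , child _ r≼s , r≼t | inj₂ (i , refl , refl) = r , vr , r≼s , r≼t

  -- A walk cannot leave the subtree below b without passing from b to its parent.
  walk-leaving-subtree : ∀ {v b s t} → Walk v s t → Ancestor b s → ¬ Ancestor b t → v ∈ bag b
  walk-leaving-subtree ε b≼s b⋠t = ⊥-elim (b⋠t b≼s)
  walk-leaving-subtree (link ◅ walk) b≼s b⋠t with proj₂ (proj₂ link)
  walk-leaving-subtree (link ◅ walk) here b⋠t | inj₁ (i , refl , refl) = proj₁ link
  walk-leaving-subtree (link ◅ walk) (child _ b≼s) b⋠t | inj₁ (i , refl , refl) =
    walk-leaving-subtree walk b≼s b⋠t
  ... | inj₂ (i , refl , refl) = walk-leaving-subtree walk (child i b≼s) b⋠t

  lowest : List Node → Node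
  lowest []       = Fin.zero
  lowest (t ∷ ts) = argmin toℕ t ts

  lowest-∈ : ∀ {t ts} → t ∈ ts → lowest ts ∈ ts
  lowest-∈ {ts = t ∷ ts} _ with argmin-sel toℕ t ts
  ... | inj₁ eq = here eq
  ... | inj₂ q  = there q

  lowest-≤ : ∀ {t ts} → t ∈ ts → toℕ (lowest ts) ≤ toℕ t
  lowest-≤ {ts = t ∷ ts} (here refl) = f[argmin]≤f[⊤] {f = toℕ} t ts
  lowest-≤ {ts = t ∷ ts} (there q)   = lookup (f[argmin]≤f[xs] {f = toℕ} t ts) q

  holders : Var → List Node
  holders v = filter (λ t → v ∈ℕ? bag t) (allFin (suc m))

  top : Var → Node
  top v = lowest (holders v)

  ∈-holders : ∀ {v t} → v ∈ bag t → t ∈ holders v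
  ∈-holders {v} {t} vt = ∈-filter⁺ (λ t → v ∈ℕ? bag t) (∈-allFin t) vt

  ∈-bag-top : ∀ {v t} → v ∈ bag t → v ∈ bag (top v)
  ∈-bag-top {v} vt = proj₂ (∈-filter⁻ (λ t → v ∈ℕ? bag t) (lowest-∈ (∈-holders vt)))

  top-Ancestor : ∀ {v t} → v ∈ bag t → Ancestor (top v) t
  top-Ancestor {v} {t} vt
    with walk-commonAncestor (connected v (top v) t (∈-bag-top vt) vt) (∈-bag-top vt)
  ... | r , vr , r≼top , r≼t with Ancestor-≥⇒≡ r≼top (lowest-≤ (∈-holders vr))
  ... | refl = r≼t

  -- Helly property of subtrees: every u ∈ K lies in the bag at the top of the subtree
  -- of the vertex v whose top has the largest index.
  clique-in-bag : ∀ (K : List Var) →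
    (∀ {u w} → u ∈ K → w ∈ K → ∃ λ t → u ∈ bag t × w ∈ bag t) →
    ∃ λ t → ∀ {u} → u ∈ K → u ∈ bag t
  clique-in-bag []      _    = Fin.zero , λ ()
  clique-in-bag (x ∷ K) meet = top v , ∈-bag-top-v
    where
    rank : Var → ℕ
    rank u = toℕ (top u)

    v : Var
    v = argmax rank x K

    v∈ : v ∈ x ∷ K
    v∈ with argmax-sel rank x K
    ... | inj₁ eq = here eq
    ... | inj₂ q  = there q

    deepest : ∀ {u} → u ∈ x ∷ K → rank u ≤ rank v
    deepest (here refl) = f[⊥]≤f[argmax] {f = rank} x K
    deepest (there q)   = lookup (f[xs]≤f[argmax] {f = rank} x K) q

    ∈-bag-top-v : ∀ {u} → u ∈ x ∷ K → u ∈ bag (top v)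
    ∈-bag-top-v {u} u∈ with meet u∈ v∈ | top u Fin.≟ top v
    ... | t , ut , vt | yes eq = subst (λ s → u ∈ bag s) eq (∈-bag-top ut)
    ... | t , ut , vt | no neq =
      walk-leaving-subtree (connected u t (top u) ut (∈-bag-top ut)) (top-Ancestor vt)
        λ v≼u → neq (sym (Ancestor-≥⇒≡ v≼u (deepest u∈)))

module PathDecomposition (N : ℕ) (bag : Fin (suc N) → List Var)
  (convex : ∀ {v s u t} → toℕ s ≤ toℕ u → toℕ u ≤ toℕ t →
            v ∈ bag s → v ∈ bag t → v ∈ bag u) where

  Walk : Var → Fin (suc N) → Fin (suc N) → Set
  Walk v = Star (TreeLink inject₁ bag v)

  walk-up : ∀ {v} d {s} t → toℕ t ≡ d + toℕ s → v ∈ bag s → v ∈ bag t → Walk v s t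
  walk-up zero t eq vs vt with toℕ-injective eq
  ... | refl = ε
  walk-up (suc d) Fin.zero    () _ _
  walk-up {v} (suc d) {s} (Fin.suc i) eq vs vt =
    walk-up d (inject₁ i) i≡d+s vs vi ◅◅ ((vi , vt , inj₂ (i , refl , refl)) ◅ ε)
    where
    i≡d+s : toℕ (inject₁ i) ≡ d + toℕ s
    i≡d+s = trans (toℕ-inject₁ i) (suc-injective eq)
    vi : v ∈ bag (inject₁ i)
    vi = convex (subst (toℕ s ≤_) (sym i≡d+s) (m≤n+m (toℕ s) d))
                (≤-trans (≤-reflexive (toℕ-inject₁ i)) (n≤1+n _)) vs vt

  connected : ∀ v s t → v ∈ bag s → v ∈ bag t → Walk v s t
  connected v s t vs vt with ≤-total (toℕ s) (toℕ t)
  ... | inj₁ s≤t = walk-up (toℕ t ∸ toℕ s) t (sym (m∸n+n≡m s≤t)) vs vt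
  ... | inj₂ t≤s = reverse TreeLink-sym (walk-up (toℕ s ∸ toℕ t) s (sym (m∸n+n≡m t≤s)) vt vs)

  pathDecomposition : ∀ {V E} → (∀ v → v ∈ V → ∃ λ t → v ∈ bag t) →
    (∀ u v → u ∈ V → v ∈ V → E u v → ∃ λ t → u ∈ bag t × v ∈ bag t) →
    TreeDecomposition V E
  pathDecomposition cover edges = record
    { m = N ; par = inject₁ ; par< = λ i → ≤-reflexive (toℕ-inject₁ i) ; bag = bag
    ; cover = cover ; edges = edges ; connected = connected }

unique-⊆⇒length≤ : ∀ {A : Set} {xs ys : List A} → Unique xs →
                   xs ⊆ ys → length xs ≤ length ys
unique-⊆⇒length≤ {xs = []}     _            _  = z≤n
unique-⊆⇒length≤ {xs = x ∷ xs} (x≢xs ∷ uniq) xs⊆ys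
  with as , bs , refl ← ∈-∃++ (xs⊆ys (here refl)) =
  subst (suc (length xs) ≤_) (sym (length-++-sucʳ as x bs))
        (s≤s (unique-⊆⇒length≤ uniq xs⊆as++bs))
  where
  xs⊆as++bs : ∀ {z} → z ∈ xs → z ∈ as ++ bs
  xs⊆as++bs {z} z∈ with ∈-++⁻ as (xs⊆ys (there z∈))
  ... | inj₁ q         = ∈-++⁺ˡ q
  ... | inj₂ (here eq) = ⊥-elim (lookup x≢xs z∈ (sym eq))
  ... | inj₂ (there q) = ∈-++⁺ʳ as q

∈-removeLit⁻ : ∀ {l l' c} → l ∈ removeLit l' c → l ∈ c × l ≢ l'
∈-removeLit⁻ {l' = l'} = ∈-filter⁻ (λ l → ¬? (l ≟L l'))

∈-removeLit⁺ : ∀ {l l' c} → l ∈ c → l ≢ l' → l ∈ removeLit l' c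
∈-removeLit⁺ {l' = l'} = ∈-filter⁺ (λ l → ¬? (l ≟L l'))

∈-restrict⁻ : ∀ {x b F c} → c ∈ restrict x b F →
              ∃ λ c₀ → c₀ ∈ F × (x , b) ∉ c₀ × c ≡ removeLit (x , not b) c₀
∈-restrict⁻ {x} {b} {F} c∈
  with c₀ , c₀∈ , eq ← ∈-map⁻ (removeLit (x , not b)) c∈
  with c₀∈F , xb∉ ← ∈-filter⁻ (λ c → ¬? ((x , b) ∈L? c)) {xs = F} c₀∈ = c₀ , c₀∈F , xb∉ , eq

∈-restrict⁺ : ∀ {x b F c} → c ∈ F → (x , b) ∉ c → removeLit (x , not b) c ∈ restrict x b F
∈-restrict⁺ {x} {b} c∈ xb∉ = ∈-map⁺ _ (∈-filter⁺ (λ c → ¬? ((x , b) ∈L? c)) c∈ xb∉)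

restrict-keeps : ∀ {x b F c} → c ∈ F → ¬ x ∈vc c → c ∈ restrict x b F
restrict-keeps {x} {b} {F} {c} c∈ x∉c =
  subst (_∈ restrict x b F) (filter-all (λ l → ¬? (l ≟L (x , not b))) no-x-literal)
        (∈-restrict⁺ c∈ λ q → x∉c (b , q))
  where
  no-x-literal : All (_≢ (x , not b)) c
  no-x-literal = All.tabulate λ l∈ eq → x∉c (not b , subst (_∈ c) eq l∈)

restrict-shrinks : ∀ {x b F c} → c ∈ restrict x b F →
                   ∃ λ c₀ → c₀ ∈ F × c ⊆ c₀ × ¬ x ∈vc c
restrict-shrinks {x} {b} c∈ with c₀ , c₀∈ , xb∉ , refl ← ∈-restrict⁻ c∈ =
  c₀ , c₀∈ , (λ q → proj₁ (∈-removeLit⁻ q)) , x∉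
  where
  x∉ : ¬ x ∈vc removeLit (x , not b) c₀
  x∉ (b' , q) with ∈-removeLit⁻ q | b' 𝔹.≟ b
  ... | q₀ , _  | yes refl = xb∉ q₀
  ... | _  , ne | no b'≢b  = ne (cong (x ,_) (¬-not b'≢b))

restrictAll-shrinks : ∀ X τ F {c} → c ∈ restrictAll X τ F →
                      ∃ λ c₀ → c₀ ∈ F × c ⊆ c₀ × (∀ {x} → x ∈ X → ¬ x ∈vc c)
restrictAll-shrinks []      τ F c∈ = _ , c∈ , id , λ ()
restrictAll-shrinks (y ∷ X) τ F c∈
  with c₁ , c₁∈ , c⊆c₁ , y∉c ← restrict-shrinks {y} {τ y} {restrictAll X τ F} c∈
  with c₀ , c₀∈ , c₁⊆c₀ , X∉c₁ ← restrictAll-shrinks X τ F c₁∈ =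
  c₀ , c₀∈ , (λ q → c₁⊆c₀ (c⊆c₁ q)) , λ where
    (here refl) → y∉c
    (there x∈)  (b , q) → X∉c₁ x∈ (b , c⊆c₁ q)

restrictAll-survivor : ∀ X τ F {c} → c ∈ F → (∀ {x} → x ∈ X → (x , τ x) ∉ c) →
  ∃ λ c' → c' ∈ restrictAll X τ F × c' ⊆ c × (∀ {l} → l ∈ c → proj₁ l ∉ X → l ∈ c')
restrictAll-survivor []      τ F c∈ _ = _ , c∈ , id , λ q _ → q
restrictAll-survivor (y ∷ X) τ F c∈ unsatisfied
  with c₁ , c₁∈ , c₁⊆c , keeps ← restrictAll-survivor X τ F c∈ (λ x∈ → unsatisfied (there x∈)) =
  removeLit (y , not (τ y)) c₁ , ∈-restrict⁺ c₁∈ (λ q → unsatisfied (here refl) (c₁⊆c q))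
  , (λ q → c₁⊆c (proj₁ (∈-removeLit⁻ q)))
  , λ q l∉ → ∈-removeLit⁺ (keeps q (λ l∈ → l∉ (there l∈))) (λ eq → l∉ (here (cong proj₁ eq)))

Connected : Formula → Clause → Clause → Set
Connected F = Star (ClauseStep AllVars F)

component-⊆ : ∀ {F F'} → IsComponent F F' → F' ⊆ F
component-⊆ (_ , _ , h) d∈ = proj₁ (proj₁ (h _) d∈)

module _ {A : Set} (P : A → Set) where

  Separation : List A → List A → Set
  Separation xs ys = ∀ y → (y ∈ ys → y ∈ xs × P y) × (y ∈ xs × P y → y ∈ ys)

  separation-∷ : ∀ {x xs ys} → Separation xs ys → Dec (P x) → ∃ (Separation (x ∷ xs))
  separation-∷ {ys = ys} h (yes px) = _ ∷ ys , λ y →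
    (λ { (here refl) → here refl , px
       ; (there q)   → there (proj₁ (proj₁ (h y) q)) , proj₂ (proj₁ (h y) q) }) ,
    (λ { (here refl , _) → here refl
       ; (there q , py)  → there (proj₂ (h y) (q , py)) })
  separation-∷ {ys = ys} h (no ¬px) = ys , λ y →
    (λ q → there (proj₁ (proj₁ (h y) q)) , proj₂ (proj₁ (h y) q)) ,
    (λ { (here refl , py) → ⊥-elim (¬px py)
       ; (there q , py)   → proj₂ (h y) (q , py) })

  separation : ∀ xs → DoubleNegation (∃ (Separation xs))
  separation []       = pure ([] , λ y → (λ ()) , λ { (() , _) })
  separation (x ∷ xs) = do
    ys , h ← separation xs
    Px? ← ¬¬-excluded-middle
    pure (separation-∷ h Px?)

-- Reachability is not decided here, so the component is only obtained under double negation,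
-- which suffices where the goal is ⊥.
component-containing : ∀ {F c} → c ∈ F →
  DoubleNegation (∃ λ F' → IsComponent F F' × (∀ {d} → d ∈ F → Connected F c d → d ∈ F'))
component-containing {F} {c} c∈ =
  ¬¬-map (λ (F' , h) → F' , (c , c∈ , h) , λ {d} d∈ c~d → proj₂ (h d) (d∈ , c~d))
         (separation (Connected F c) F)

InClass⇒DepthLe : ∀ 𝒞 k {F} → InClass 𝒞 F → DepthLe 𝒞 F k
InClass⇒DepthLe 𝒞 zero    inC = inC
InClass⇒DepthLe 𝒞 (suc k) inC F' F'-comp = inj₁ λ d d∈ → inC d (component-⊆ F'-comp d∈)

-- A clause of 𝒞 contains at most one literal of polarity `limited 𝒞`
-- (for Krom, at most two literals of either polarity).
limited : BaseClass → Bool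
limited Horn  = true
limited dHorn = false
limited Krom  = true

ClauseIn-empty : ∀ 𝒞 {c} → (∀ {l} → l ∉ c) → ClauseIn 𝒞 c
ClauseIn-empty Horn  empty _ _ p = ⊥-elim (empty p)
ClauseIn-empty dHorn empty _ _ p = ⊥-elim (empty p)
ClauseIn-empty Krom  empty _ _ _ p = ⊥-elim (empty p)

ClauseIn-Krom-pair : ∀ {l₁ l₂ c} → (∀ {l} → l ∈ c → l ≡ l₁ ⊎ l ≡ l₂) → ClauseIn Krom c
ClauseIn-Krom-pair pair _ _ _ p₁ p₂ p₃ with pair p₁ | pair p₂ | pair p₃
... | inj₁ refl | inj₁ refl | _         = inj₁ refl
... | inj₂ refl | inj₂ refl | _         = inj₁ refl
... | inj₁ refl | inj₂ refl | inj₁ refl = inj₂ (inj₁ refl)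
... | inj₁ refl | inj₂ refl | inj₂ refl = inj₂ (inj₂ refl)
... | inj₂ refl | inj₁ refl | inj₁ refl = inj₂ (inj₂ refl)
... | inj₂ refl | inj₁ refl | inj₂ refl = inj₂ (inj₁ refl)

ClauseIn-unlimited-pair : ∀ 𝒞 {x y c} →
  (∀ {l} → l ∈ c → l ≡ (x , not (limited 𝒞)) ⊎ l ≡ (y , not (limited 𝒞))) → ClauseIn 𝒞 c
ClauseIn-unlimited-pair Horn pair _ _ p _ with pair p
... | inj₁ ()
... | inj₂ ()
ClauseIn-unlimited-pair dHorn pair _ _ p _ with pair p
... | inj₁ ()
... | inj₂ ()
ClauseIn-unlimited-pair Krom pair = ClauseIn-Krom-pair pair

∈-uniform⁻ : ∀ {b b' : Bool} {x : Var} {xs : List Var} → (x , b') ∈ map (_, b) xs → b' ≡ b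
∈-uniform⁻ {b} l∈ with _ , _ , refl ← ∈-map⁻ (_, b) l∈ = refl

∉-uniform : ∀ {b : Bool} {x : Var} {xs : List Var} → (x , not b) ∉ map (_, b) xs
∉-uniform l∈ = not-¬ refl (sym (∈-uniform⁻ l∈))

uniform-NoCompl : ∀ b (xs : List Var) → NoCompl (map (_, b) xs)
uniform-NoCompl b xs x pos neg with trans (∈-uniform⁻ pos) (sym (∈-uniform⁻ neg))
... | ()

Covers : List Var → Formula → Set
Covers X F = ∀ {c x} → c ∈ F → x ∈vc c → x ∈ X

covering-backdoor : ∀ 𝒞 {X F} → (∀ {x} → x ∈ X → x ∈var F) → Covers X F → IsBackdoor 𝒞 F X
covering-backdoor 𝒞 {X} {F} X⊆var covers = (λ _ x∈ → X⊆var x∈) , λ τ c c∈ →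
  ClauseIn-empty 𝒞 (emptied τ c∈)
  where
  emptied : ∀ τ {c l} → c ∈ restrictAll X τ F → l ∉ c
  emptied τ {l = x , b} c∈ l∈ with c₀ , c₀∈ , c⊆c₀ , X∉c ← restrictAll-shrinks X τ F c∈ =
    X∉c (covers c₀∈ (b , c⊆c₀ l∈)) (b , l∈)

covering-torsoEdge : ∀ {X F u v} → Covers X F → TorsoEdge F X u v →
                     ∃ λ c → c ∈ F × u ∈vc c × v ∈vc c
covering-torsoEdge _ (_ , _ , _ , inj₁ shared) = shared
covering-torsoEdge _ (_ , _ , _ , inj₂ (c , _ , c∈ , _ , uc , vc , ε)) = c , c∈ , uc , vc
covering-torsoEdge covers
  (_ , _ , _ , inj₂ (_ , _ , _ , _ , _ , _ , (c∈ , _ , z , z∉X , zc , _) ◅ _)) =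
  ⊥-elim (z∉X (covers c∈ zc))

-- Path formulas: backdoor treewidth 2, unbounded depth

pathBag : ℕ → List Var
pathBag i = i ∷ suc i ∷ suc (suc i) ∷ []

∈-pathBag⁻ : ∀ {i x} → x ∈ pathBag i → i ≤ x × x ≤ 2 + i
∈-pathBag⁻ {i} (here refl)                 = ≤-refl , m≤n+m i 2
∈-pathBag⁻ {i} (there (here refl))         = n≤1+n i , n≤1+n (suc i)
∈-pathBag⁻ {i} (there (there (here refl))) = m≤n+m i 2 , ≤-refl

∈-pathBag⁺ : ∀ {i x} → i ≤ x → x ≤ 2 + i → x ∈ pathBag i
∈-pathBag⁺ i≤x x≤ with m≤n⇒m<n∨m≡n i≤x
... | inj₂ refl = here refl
... | inj₁ i<x with m≤n⇒m<n∨m≡n i<x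
... | inj₂ refl = there (here refl)
... | inj₁ 1+i<x = there (there (here (≤-antisym x≤ 1+i<x)))

pathBag-convex : ∀ {v s u t} → s ≤ u → u ≤ t → v ∈ pathBag s → v ∈ pathBag t → v ∈ pathBag u
pathBag-convex s≤u u≤t vs vt =
  ∈-pathBag⁺ (≤-trans u≤t (proj₁ (∈-pathBag⁻ vt)))
             (≤-trans (proj₂ (∈-pathBag⁻ vs)) (s≤s (s≤s s≤u)))

pathClause : BaseClass → ℕ → Clause
pathClause 𝒞 i = map (_, limited 𝒞) (pathBag i)

∈vc-pathClause⁻ : ∀ {𝒞 i x} → x ∈vc pathClause 𝒞 i → x ∈ pathBag i
∈vc-pathClause⁻ (_ , here refl)                 = here refl
∈vc-pathClause⁻ (_ , there (here refl))         = there (here refl)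
∈vc-pathClause⁻ (_ , there (there (here refl))) = there (there (here refl))

∈vc-pathClause⁺ : ∀ {𝒞 i x} → x ∈ pathBag i → x ∈vc pathClause 𝒞 i
∈vc-pathClause⁺ {𝒞} x∈ = limited 𝒞 , ∈-map⁺ (_, limited 𝒞) x∈

pathClause-∉ : ∀ {𝒞 i} → ¬ ClauseIn 𝒞 (pathClause 𝒞 i)
pathClause-∉ {Horn}  {i} inC = <⇒≢ (n<1+n i) (inC _ _ (here refl) (there (here refl)))
pathClause-∉ {dHorn} {i} inC = <⇒≢ (n<1+n i) (inC _ _ (here refl) (there (here refl)))
pathClause-∉ {Krom}  {i} inC
  with inC _ _ _ (here refl) (there (here refl)) (there (there (here refl)))
... | inj₁ eq         = <⇒≢ (n<1+n i) (cong proj₁ eq)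
... | inj₂ (inj₁ eq) = <⇒≢ (m<n+m i (s≤s z≤n)) (cong proj₁ eq)
... | inj₂ (inj₂ eq) = <⇒≢ (n<1+n (suc i)) (cong proj₁ eq)

pathFormula : BaseClass → ℕ → Formula
pathFormula 𝒞 N = map (pathClause 𝒞) (upTo (suc N))

∈-pathFormula⁻ : ∀ {𝒞 N c} → c ∈ pathFormula 𝒞 N → ∃ λ i → i < suc N × c ≡ pathClause 𝒞 i
∈-pathFormula⁻ {𝒞} c∈ with i , i∈ , eq ← ∈-map⁻ (pathClause 𝒞) c∈ = i , ∈-upTo⁻ i∈ , eq

pathClause∈ : ∀ {𝒞 N i} → i < suc N → pathClause 𝒞 i ∈ pathFormula 𝒞 N
pathClause∈ {𝒞} i< = ∈-map⁺ (pathClause 𝒞) (∈-upTo⁺ i<)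

pathVars : ℕ → List Var
pathVars N = upTo (3 + N)

pathVar-home : ∀ {N x} → x ∈ pathVars N → ∃ λ i → i < suc N × x ∈ pathBag i
pathVar-home {x = zero}        _  = 0 , s≤s z≤n , here refl
pathVar-home {x = suc zero}    _  = 0 , s≤s z≤n , there (here refl)
pathVar-home {x = suc (suc w)} x∈ = w , s≤s⁻¹ (s≤s⁻¹ (∈-upTo⁻ x∈)) , there (there (here refl))

pathVars-covers : ∀ {𝒞 N} → Covers (pathVars N) (pathFormula 𝒞 N)
pathVars-covers {𝒞} {N} c∈ xc with i , i< , refl ← ∈-pathFormula⁻ {𝒞} {N} c∈ =
  ∈-upTo⁺ (s≤s (≤-trans (proj₂ (∈-pathBag⁻ (∈vc-pathClause⁻ {𝒞} xc))) (s≤s (s≤s (s≤s⁻¹ i<)))))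

pathFormula-bdtw≤2 : ∀ 𝒞 N → BdtwLe 𝒞 (pathFormula 𝒞 N) 2
pathFormula-bdtw≤2 𝒞 N =
  pathVars N , covering-backdoor 𝒞 pathVars⊆var pathVars-covers ,
  pathDecomposition cover edges , λ _ → ≤-refl
  where
  open PathDecomposition N (pathBag ∘ toℕ) pathBag-convex

  at : ∀ {i x} (i< : i < suc N) → x ∈ pathBag i → x ∈ pathBag (toℕ (fromℕ< i<))
  at {x = x} i< = subst (λ k → x ∈ pathBag k) (sym (toℕ-fromℕ< i<))

  pathVars⊆var : ∀ {x} → x ∈ pathVars N → x ∈var pathFormula 𝒞 N
  pathVars⊆var x∈ with i , i< , x∈bag ← pathVar-home x∈ =
    pathClause 𝒞 i , pathClause∈ i< , ∈vc-pathClause⁺ x∈bag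

  cover : ∀ x → x ∈ pathVars N → ∃ λ t → x ∈ pathBag (toℕ t)
  cover x x∈ with i , i< , x∈bag ← pathVar-home x∈ = fromℕ< i< , at i< x∈bag

  edges : ∀ u v → u ∈ pathVars N → v ∈ pathVars N → TorsoEdge (pathFormula 𝒞 N) (pathVars N) u v →
          ∃ λ t → u ∈ pathBag (toℕ t) × v ∈ pathBag (toℕ t)
  edges u v _ _ e
    with c , c∈ , uc , vc ← covering-torsoEdge (pathVars-covers {𝒞}) e
    with i , i< , refl ← ∈-pathFormula⁻ {𝒞} {N} c∈ =
    fromℕ< i< , at i< (∈vc-pathClause⁻ {𝒞} uc) , at i< (∈vc-pathClause⁻ {𝒞} vc)

windowLength : ℕ → ℕ
windowLength zero    = 1
windowLength (suc n) = 3 + (windowLength n + windowLength n)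

0<windowLength : ∀ n → 0 < windowLength n
0<windowLength zero    = s≤s z≤n
0<windowLength (suc n) = s≤s z≤n

Window : BaseClass → ℕ → ℕ → Formula → Set
Window 𝒞 n a F = ∀ {i} → a ≤ i → i < a + windowLength n → pathClause 𝒞 i ∈ F

window-start : ∀ {𝒞 n a F} → Window 𝒞 n a F → pathClause 𝒞 a ∈ F
window-start {n = n} {a} w = w ≤-refl (m<m+n a (0<windowLength n))

run-connected : ∀ {𝒞 F} a j → (∀ {t} → t ≤ j → pathClause 𝒞 (t + a) ∈ F) →
                Connected F (pathClause 𝒞 a) (pathClause 𝒞 (j + a))
run-connected a zero    run = ε
run-connected {𝒞} a (suc j) run =
  run-connected a j (λ t≤j → run (m≤n⇒m≤1+n t≤j)) ◅◅ (step ◅ ε)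
  where
  step : ClauseStep AllVars _ (pathClause 𝒞 (j + a)) (pathClause 𝒞 (suc j + a))
  step = run (n≤1+n j) , run ≤-refl , suc (j + a) , tt ,
         (limited 𝒞 , there (here refl)) , (limited 𝒞 , here refl)

window-connected : ∀ {𝒞 n a F i} → Window 𝒞 n a F → a ≤ i → i < a + windowLength n →
                   Connected F (pathClause 𝒞 a) (pathClause 𝒞 i)
window-connected {𝒞} {n} {a} {F} {i} w a≤i i< =
  subst (λ k → Connected F (pathClause 𝒞 a) (pathClause 𝒞 k)) (m∸n+n≡m a≤i)
        (run-connected {𝒞} {F} a (i ∸ a) λ {t} t≤ → w (m≤n+m a t) (≤-<-trans (t+a≤i t≤) i<))
  where
  t+a≤i : ∀ {t} → t ≤ i ∸ a → t + a ≤ i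
  t+a≤i t≤ = subst (_ ≤_) (m∸n+n≡m a≤i) (+-monoˡ-≤ a t≤)

window-in-component : ∀ {𝒞 n a F F'} → Window 𝒞 n a F →
  (∀ {d} → d ∈ F → Connected F (pathClause 𝒞 a) d → d ∈ F') → Window 𝒞 n a F'
window-in-component {𝒞} {n} w ⊇component a≤i i< =
  ⊇component (w a≤i i<) (window-connected {𝒞} {n} w a≤i i<)

untouched-pathClause : ∀ {𝒞 i x} → x < i ⊎ 2 + i < x → ¬ x ∈vc pathClause 𝒞 i
untouched-pathClause {𝒞} (inj₁ x<i) xc = <⇒≱ x<i (proj₁ (∈-pathBag⁻ (∈vc-pathClause⁻ {𝒞} xc)))
untouched-pathClause {𝒞} (inj₂ 2+i<x) xc = <⇒≱ 2+i<x (proj₂ (∈-pathBag⁻ (∈vc-pathClause⁻ {𝒞} xc)))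

-- A variable meets at most three consecutive clauses, so one half of the window survives.
window-restrict : ∀ {𝒞 n a F} x b → Window 𝒞 (suc n) a F →
                  ∃ λ a' → Window 𝒞 n a' (restrict x b F)
window-restrict {𝒞} {n} {a} {F} x b w = surviving-half (x <? a + (2 + L))
  where
  L = windowLength n

  keep : ∀ {i} → a ≤ i → i < a + windowLength (suc n) → x < i ⊎ 2 + i < x →
         pathClause 𝒞 i ∈ restrict x b F
  keep a≤i i< away = restrict-keeps (w a≤i i<) (untouched-pathClause {𝒞} away)

  mid≡ : a + (2 + L) ≡ 2 + (a + L)
  mid≡ = trans (+-suc a (suc L)) (cong suc (+-suc a L))

  surviving-half : Dec (x < a + (2 + L)) → ∃ λ a' → Window 𝒞 n a' (restrict x b F)
  surviving-half (yes x<mid) = a + (3 + L) , λ {i} a'≤i i< →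
    keep (≤-trans (m≤m+n a _) a'≤i) (subst (i <_) (+-assoc a (3 + L) L) i<)
         (inj₁ (<-≤-trans x<mid (≤-trans (+-monoʳ-≤ a (n≤1+n _)) a'≤i)))
  surviving-half (no x≮mid) = a , λ {i} a≤i i< →
    keep a≤i (<-≤-trans i< (+-monoʳ-≤ a (≤-trans (m≤m+n L L) (m≤n+m _ 3))))
         (inj₂ (≤-trans (s≤s (s≤s i<)) (subst (_≤ x) mid≡ (≮⇒≥ x≮mid))))

window⇒¬DepthLe : ∀ {𝒞} n {a F} → Window 𝒞 n a F → ¬ DepthLe 𝒞 F n
window⇒¬DepthLe {𝒞} zero w inC = pathClause-∉ (inC _ (window-start {𝒞} {0} w))
window⇒¬DepthLe {𝒞} (suc n) w D =
  component-containing (window-start {𝒞} {suc n} w) λ (F' , F'-comp , ⊇component) →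
  let w' = window-in-component {𝒞} {suc n} w ⊇component in
  case D F' F'-comp of λ where
    (inj₁ inC)          → pathClause-∉ (inC _ (window-start {𝒞} {suc n} w'))
    (inj₂ (x , _ , D')) → window⇒¬DepthLe n (proj₂ (window-restrict {𝒞} {n} x false w')) (D' false)

pathFormula-window : ∀ 𝒞 n → Window 𝒞 n 0 (pathFormula 𝒞 (windowLength n))
pathFormula-window 𝒞 n _ i< = pathClause∈ (m≤n⇒m≤1+n i<)

WF-pathFormula : ∀ 𝒞 N → WF (pathFormula 𝒞 N)
WF-pathFormula 𝒞 N c c∈ with _ , _ , refl ← ∈-pathFormula⁻ {𝒞} {N} c∈ = uniform-NoCompl _ _

-- Gadget formulas: depth 2, unbounded backdoor treewidth

-- Variable 0 is the hub; gadget i owns the variables 1 + 3i + j for j < 3.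
hub : Var
hub = 0

slot : ℕ → ℕ → ℕ
slot zero    j = j
slot (suc i) j = 3 + slot i j

slot-injective : ∀ i i' {j j'} → j < 3 → j' < 3 → slot i j ≡ slot i' j' → i ≡ i' × j ≡ j'
slot-injective zero     zero     _   _   eq   = refl , eq
slot-injective zero     (suc i') j<3 _   refl = ⊥-elim (<⇒≱ j<3 (m≤m+n 3 _))
slot-injective (suc i)  zero     _   j'<3 refl = ⊥-elim (<⇒≱ j'<3 (m≤m+n 3 _))
slot-injective (suc i)  (suc i') j<3 j'<3 eq
  with refl , j≡j' ← slot-injective i i' j<3 j'<3 (+-cancelˡ-≡ 3 _ _ eq) = refl , j≡j'

gadgetVar : ℕ → ℕ → Var
gadgetVar i j = suc (slot i j)

-- One variable more than a clause of the class may contain with polarity `limited 𝒞`.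
gadgetVars : BaseClass → ℕ → List Var
gadgetVars Horn  i = gadgetVar i 0 ∷ gadgetVar i 1 ∷ []
gadgetVars dHorn i = gadgetVar i 0 ∷ gadgetVar i 1 ∷ []
gadgetVars Krom  i = gadgetVar i 0 ∷ gadgetVar i 1 ∷ gadgetVar i 2 ∷ []

gadgetVars⁻ : ∀ 𝒞 {i v} → v ∈ gadgetVars 𝒞 i → ∃ λ j → j < 3 × v ≡ gadgetVar i j
gadgetVars⁻ Horn  (here refl)                 = 0 , z<s , refl
gadgetVars⁻ Horn  (there (here refl))         = 1 , s<s z<s , refl
gadgetVars⁻ dHorn (here refl)                 = 0 , z<s , refl
gadgetVars⁻ dHorn (there (here refl))         = 1 , s<s z<s , refl
gadgetVars⁻ Krom  (here refl)                 = 0 , z<s , refl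
gadgetVars⁻ Krom  (there (here refl))         = 1 , s<s z<s , refl
gadgetVars⁻ Krom  (there (there (here refl))) = 2 , s<s (s<s z<s) , refl

gadgetVars-disjoint : ∀ 𝒞 {i i' v} → v ∈ gadgetVars 𝒞 i → v ∈ gadgetVars 𝒞 i' → i ≡ i'
gadgetVars-disjoint 𝒞 {i} {i'} v∈ v∈'
  with j , j<3 , refl ← gadgetVars⁻ 𝒞 v∈ | j' , j'<3 , eq ← gadgetVars⁻ 𝒞 v∈' =
  proj₁ (slot-injective i i' j<3 j'<3 (suc-injective eq))

gadgetVar₀∈ : ∀ 𝒞 i → gadgetVar i 0 ∈ gadgetVars 𝒞 i
gadgetVar₀∈ Horn  i = here refl
gadgetVar₀∈ dHorn i = here refl
gadgetVar₀∈ Krom  i = here refl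

gadgetLits : BaseClass → ℕ → Clause
gadgetLits 𝒞 i = map (_, limited 𝒞) (gadgetVars 𝒞 i)

∈-gadgetLits⁻ : ∀ {𝒞 i x b} → (x , b) ∈ gadgetLits 𝒞 i → b ≡ limited 𝒞 × x ∈ gadgetVars 𝒞 i
∈-gadgetLits⁻ {𝒞} l∈ with _ , x∈ , refl ← ∈-map⁻ (_, limited 𝒞) l∈ = refl , x∈

gadgetVar-≢ : ∀ i {j j'} → j < 3 → j' < 3 → j ≢ j' → gadgetVar i j ≢ gadgetVar i j'
gadgetVar-≢ i j<3 j'<3 j≢j' eq = j≢j' (proj₂ (slot-injective i i j<3 j'<3 (suc-injective eq)))

gadget-∉ : ∀ 𝒞 i {c} → gadgetLits 𝒞 i ⊆ c → ¬ ClauseIn 𝒞 c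
gadget-∉ Horn  i ⊆c inC =
  gadgetVar-≢ i z<s (s<s z<s) (λ ()) (inC _ _ (⊆c (here refl)) (⊆c (there (here refl))))
gadget-∉ dHorn i ⊆c inC =
  gadgetVar-≢ i z<s (s<s z<s) (λ ()) (inC _ _ (⊆c (here refl)) (⊆c (there (here refl))))
gadget-∉ Krom  i ⊆c inC
  with inC _ _ _ (⊆c (here refl)) (⊆c (there (here refl))) (⊆c (there (there (here refl))))
... | inj₁ eq         = gadgetVar-≢ i z<s (s<s z<s) (λ ()) (cong proj₁ eq)
... | inj₂ (inj₁ eq) = gadgetVar-≢ i z<s (s<s (s<s z<s)) (λ ()) (cong proj₁ eq)
... | inj₂ (inj₂ eq) = gadgetVar-≢ i (s<s z<s) (s<s (s<s z<s)) (λ ()) (cong proj₁ eq)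

gadget-tail-∈ : ∀ 𝒞 i {c} → (∀ {l} → l ∈ c → l ∈ gadgetLits 𝒞 i × proj₁ l ≢ gadgetVar i 0) →
                ClauseIn 𝒞 c
gadget-tail-∈ Horn i tail _ _ p q with tail p | tail q
... | here refl , x≢ | _ = ⊥-elim (x≢ refl)
... | _ | here refl , y≢ = ⊥-elim (y≢ refl)
... | there (here refl) , _ | there (here refl) , _ = refl
gadget-tail-∈ dHorn i tail _ _ p q with tail p | tail q
... | here refl , x≢ | _ = ⊥-elim (x≢ refl)
... | _ | here refl , y≢ = ⊥-elim (y≢ refl)
... | there (here refl) , _ | there (here refl) , _ = refl
gadget-tail-∈ Krom i tail = ClauseIn-Krom-pair pair
  where
  pair : ∀ {l} → l ∈ _ → l ≡ (gadgetVar i 1 , true) ⊎ l ≡ (gadgetVar i 2 , true)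
  pair l∈ with tail l∈
  ... | here refl , x≢                 = ⊥-elim (x≢ refl)
  ... | there (here refl) , _          = inj₁ refl
  ... | there (there (here refl)) , _  = inj₂ refl

gadgetClause : BaseClass → ℕ → Clause
gadgetClause 𝒞 i = map (_, limited 𝒞) (hub ∷ gadgetVars 𝒞 i)

linkClause : BaseClass → Var → Var → Clause
linkClause 𝒞 u v = map (_, not (limited 𝒞)) (hub ∷ u ∷ v ∷ [])

allGadgetVars : BaseClass → ℕ → List Var
allGadgetVars 𝒞 n = concatMap (gadgetVars 𝒞) (upTo n)

gadgetFormula : BaseClass → ℕ → Formula
gadgetFormula 𝒞 n =
  map (gadgetClause 𝒞) (upTo n) ++ map (uncurry (linkClause 𝒞)) (cartesianProduct vs vs)
  where vs = allGadgetVars 𝒞 n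

∈-gadgetFormula⁻ : ∀ {𝒞 n c} → c ∈ gadgetFormula 𝒞 n →
  (∃ λ i → c ≡ gadgetClause 𝒞 i) ⊎ (∃₂ λ u v → c ≡ linkClause 𝒞 u v)
∈-gadgetFormula⁻ {𝒞} {n} c∈ with ∈-++⁻ (map (gadgetClause 𝒞) (upTo n)) c∈
... | inj₁ q with i , _ , eq ← ∈-map⁻ (gadgetClause 𝒞) q = inj₁ (i , eq)
... | inj₂ q with (u , v) , _ , eq ← ∈-map⁻ (uncurry (linkClause 𝒞)) q = inj₂ (u , v , eq)

gadgetClause∈ : ∀ {𝒞 n i} → i < n → gadgetClause 𝒞 i ∈ gadgetFormula 𝒞 n
gadgetClause∈ {𝒞} i<n = ∈-++⁺ˡ (∈-map⁺ (gadgetClause 𝒞) (∈-upTo⁺ i<n))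

∈-allGadgetVars⁺ : ∀ {𝒞 n i v} → i < n → v ∈ gadgetVars 𝒞 i → v ∈ allGadgetVars 𝒞 n
∈-allGadgetVars⁺ {𝒞} i<n v∈ = ∈-concatMap⁺ (gadgetVars 𝒞) (lose (∈-upTo⁺ i<n) v∈)

linkClause∈ : ∀ {𝒞 n u v} → u ∈ allGadgetVars 𝒞 n → v ∈ allGadgetVars 𝒞 n →
              linkClause 𝒞 u v ∈ gadgetFormula 𝒞 n
linkClause∈ {𝒞} {n} u∈ v∈ =
  ∈-++⁺ʳ (map (gadgetClause 𝒞) (upTo n))
         (∈-map⁺ (uncurry (linkClause 𝒞)) (∈-cartesianProduct⁺ u∈ v∈))

module GadgetDepth (𝒞 : BaseClass) (n : ℕ) where

  F : Formula
  F = gadgetFormula 𝒞 n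

  ℓ : Bool
  ℓ = limited 𝒞

  hub∈vc : ∀ {c} → c ∈ F → hub ∈vc c
  hub∈vc c∈ with ∈-gadgetFormula⁻ {𝒞} {n} c∈
  ... | inj₁ (_ , refl)     = ℓ , here refl
  ... | inj₂ (_ , _ , refl) = not ℓ , here refl

  hub-satisfied : ∀ {G} → G ⊆ F → InClass 𝒞 (restrict hub ℓ G)
  hub-satisfied {G} G⊆F d d∈ with c₀ , c₀∈ , hubℓ∉ , refl ← ∈-restrict⁻ {hub} {ℓ} {G} d∈
    with ∈-gadgetFormula⁻ {𝒞} {n} (G⊆F c₀∈)
  ... | inj₁ (_ , refl)     = ⊥-elim (hubℓ∉ (here refl))
  ... | inj₂ (u , v , refl) = ClauseIn-unlimited-pair 𝒞 pair
    where
    pair : ∀ {l} → l ∈ removeLit (hub , not ℓ) (linkClause 𝒞 u v) →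
           l ≡ (u , not ℓ) ⊎ l ≡ (v , not ℓ)
    pair l∈ with ∈-removeLit⁻ {l' = hub , not ℓ} {linkClause 𝒞 u v} l∈
    ... | here refl , l≢                 = ⊥-elim (l≢ refl)
    ... | there (here refl) , _          = inj₁ refl
    ... | there (there (here refl)) , _  = inj₂ refl

  ∈-hub-falsified⁻ : ∀ {G d} → G ⊆ F → d ∈ restrict hub (not ℓ) G →
                     ∃ λ i → d ⊆ gadgetLits 𝒞 i × (gadgetVar i 0 , ℓ) ∈ d
  ∈-hub-falsified⁻ {G} G⊆F d∈ with c₀ , c₀∈ , hub¬ℓ∉ , refl ← ∈-restrict⁻ {hub} {not ℓ} {G} d∈
    with ∈-gadgetFormula⁻ {𝒞} {n} (G⊆F c₀∈)
  ... | inj₂ (_ , _ , refl) = ⊥-elim (hub¬ℓ∉ (here refl))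
  ... | inj₁ (i , refl) = i , ⊆lits ,
    ∈-removeLit⁺ {l' = hub , not (not ℓ)} {gadgetClause 𝒞 i}
                 (there (∈-map⁺ (_, ℓ) (gadgetVar₀∈ 𝒞 i))) λ ()
    where
    ⊆lits : removeLit (hub , not (not ℓ)) (gadgetClause 𝒞 i) ⊆ gadgetLits 𝒞 i
    ⊆lits l∈ with ∈-removeLit⁻ {l' = hub , not (not ℓ)} {gadgetClause 𝒞 i} l∈
    ... | here refl , l≢ = ⊥-elim (l≢ (cong (hub ,_) (sym (not-involutive ℓ))))
    ... | there q   , _  = q

  connected-same-gadget : ∀ {G c d i} → G ⊆ F → c ⊆ gadgetLits 𝒞 i →
    Connected (restrict hub (not ℓ) G) c d → d ⊆ gadgetLits 𝒞 i
  connected-same-gadget G⊆F c⊆ ε = c⊆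
  connected-same-gadget G⊆F c⊆ ((_ , c'∈ , _ , _ , (_ , zc) , (_ , zc')) ◅ walk)
    with j , c'⊆ , _ ← ∈-hub-falsified⁻ G⊆F c'∈
    with refl ← gadgetVars-disjoint 𝒞 (proj₂ (∈-gadgetLits⁻ (c⊆ zc)))
                                      (proj₂ (∈-gadgetLits⁻ (c'⊆ zc'))) =
    connected-same-gadget G⊆F c'⊆ walk

  -- Each component now lies inside one gadget, and assigning its first variable leaves the class.
  hub-falsified-depth≤1 : ∀ {G} → G ⊆ F → DepthLe 𝒞 (restrict hub (not ℓ) G) 1
  hub-falsified-depth≤1 G⊆F G' (c , c∈ , G'-comp)
    with i , c⊆ , x∈c ← ∈-hub-falsified⁻ G⊆F c∈ =
    inj₂ (gadgetVar i 0 , (c , proj₂ (G'-comp c) (c∈ , ε) , ℓ , x∈c) , λ b d d∈ →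
      gadget-tail-∈ 𝒞 i (tail b d∈))
    where
    tail : ∀ b {d l} → d ∈ restrict (gadgetVar i 0) b G' → l ∈ d →
           l ∈ gadgetLits 𝒞 i × proj₁ l ≢ gadgetVar i 0
    tail b d∈ l∈ with d₀ , d₀∈ , d⊆d₀ , x∉d ← restrict-shrinks {gadgetVar i 0} {b} {G'} d∈ =
      connected-same-gadget G⊆F c⊆ (proj₂ (proj₁ (G'-comp d₀) d₀∈)) (d⊆d₀ l∈) ,
      λ { refl → x∉d (_ , l∈) }

  depth≤2 : DepthLe 𝒞 F 2
  depth≤2 F' F'-comp@(c , c∈ , reach) =
    inj₂ (hub , (c , proj₂ (reach c) (c∈ , ε) , hub∈vc c∈) , branch)
    where
    F'⊆F : F' ⊆ F
    F'⊆F = component-⊆ F'-comp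
    branch : ∀ b → DepthLe 𝒞 (restrict hub b F') 1
    branch b with b 𝔹.≟ ℓ
    ... | yes refl = InClass⇒DepthLe 𝒞 1 (hub-satisfied F'⊆F)
    ... | no b≢ℓ rewrite ¬-not b≢ℓ = hub-falsified-depth≤1 F'⊆F

module GadgetBdtw (𝒞 : BaseClass) (n : ℕ) (X : List Var)
                  (backdoor : ∀ τ → InClass 𝒞 (restrictAll X τ (gadgetFormula 𝒞 n))) where

  F : Formula
  F = gadgetFormula 𝒞 n

  ℓ : Bool
  ℓ = limited 𝒞

  -- Otherwise falsifying the limited literals on X leaves gadget i intact.
  hit : ∀ {i} → i < n → ∃ λ w → w ∈ X × w ∈ gadgetVars 𝒞 i
  hit {i} i<n with any? (_∈ℕ? X) (gadgetVars 𝒞 i)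
  ... | yes some with w , w∈g , w∈X ← find some = w , w∈X , w∈g
  ... | no none
    with c' , c'∈ , _ , keeps ←
           restrictAll-survivor X (λ _ → not ℓ) F (gadgetClause∈ i<n) (λ _ → ∉-uniform) =
    ⊥-elim (gadget-∉ 𝒞 i lits⊆c' (backdoor (λ _ → not ℓ) c' c'∈))
    where
    lits⊆c' : gadgetLits 𝒞 i ⊆ c'
    lits⊆c' {x , b} l∈ = keeps (there l∈) λ x∈X → none (lose (proj₂ (∈-gadgetLits⁻ l∈)) x∈X)

  HittingList : ℕ → List Var → Set
  HittingList m K = length K ≡ m × Unique K ×
                    (∀ {v} → v ∈ K → v ∈ X × ∃ λ i → i < m × v ∈ gadgetVars 𝒞 i)

  hittingList : ∀ m → m ≤ n → ∃ (HittingList m)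
  hittingList zero    _   = [] , refl , [] , λ ()
  hittingList (suc m) m<n
    with K , refl , uniq , K-hits ← hittingList m (<⇒≤ m<n) | w , w∈X , w∈g ← hit m<n =
    w ∷ K , refl , All.tabulate w∉K ∷ uniq , λ where
      (here refl) → w∈X , m , n<1+n m , w∈g
      (there v∈)  → let v∈X , i , i<m , v∈g = K-hits v∈ in v∈X , i , m≤n⇒m≤1+n i<m , v∈g
    where
    w∉K : ∀ {v} → v ∈ K → w ≢ v
    w∉K v∈ refl = let _ , i , i<m , v∈g = K-hits v∈ in <⇒≢ i<m (gadgetVars-disjoint 𝒞 v∈g w∈g)

  common-linkClause : ∀ {i j u v} → i < n → j < n → u ∈ gadgetVars 𝒞 i → v ∈ gadgetVars 𝒞 j →
           ∃ λ c → c ∈ F × u ∈vc c × v ∈vc c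
  common-linkClause {u = u} {v} i<n j<n u∈ v∈ =
    linkClause 𝒞 u v , linkClause∈ {𝒞} {n} (∈-allGadgetVars⁺ i<n u∈) (∈-allGadgetVars⁺ j<n v∈) ,
    (not ℓ , there (here refl)) , (not ℓ , there (there (here refl)))

  -- The hitting list is a clique of the torso, so it fits into a single bag.
  large-bag : ∀ (T : TreeDecomposition X (TorsoEdge F X)) →
              ∃ λ t → n ≤ length (TreeDecomposition.bag T t)
  large-bag T with K , |K|≡n , uniq , K-hits ← hittingList n ≤-refl =
    holder , subst (_≤ length (bag holder)) |K|≡n (unique-⊆⇒length≤ uniq K⊆bag)
    where
    open TreeDecomposition T
    meet : ∀ {u v} → u ∈ K → v ∈ K → ∃ λ t → u ∈ bag t × v ∈ bag t
    meet {u} {v} u∈ v∈ with K-hits u∈ | K-hits v∈ | u ℕ.≟ v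
    ... | u∈X , _ | _ | yes refl = let t , ut = cover u u∈X in t , ut , ut
    ... | u∈X , i , i<n , u∈g | v∈X , j , j<n , v∈g | no u≢v =
      edges u v u∈X v∈X (u∈X , v∈X , u≢v , inj₁ (common-linkClause i<n j<n u∈g v∈g))
    holder : Fin (suc m)
    holder = proj₁ (TreeDecompositionProperties.clique-in-bag T K meet)
    K⊆bag : ∀ {u} → u ∈ K → u ∈ bag holder
    K⊆bag = proj₂ (TreeDecompositionProperties.clique-in-bag T K meet)

gadgetFormula-¬bdtw : ∀ 𝒞 k → ¬ BdtwLe 𝒞 (gadgetFormula 𝒞 (2 + k)) k
gadgetFormula-¬bdtw 𝒞 k (X , (_ , backdoor) , T , width)
  with t , 2+k≤|bag| ← GadgetBdtw.large-bag 𝒞 (2 + k) X backdoor T =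
  1+n≰n (≤-trans 2+k≤|bag| (width t))

WF-gadgetFormula : ∀ 𝒞 n → WF (gadgetFormula 𝒞 n)
WF-gadgetFormula 𝒞 n c c∈ with ∈-gadgetFormula⁻ {𝒞} {n} c∈
... | inj₁ (_ , refl)     = uniform-NoCompl _ _
... | inj₂ (_ , _ , refl) = uniform-NoCompl _ _

¬depth-dominates-bdtw : ∀ 𝒞 → ¬ Dominates (DepthLe 𝒞) (BdtwLe 𝒞)
¬depth-dominates-bdtw 𝒞 dominates
  with k , depth≤k ← dominates (λ F → ∃ λ N → F ≡ pathFormula 𝒞 N)
                               (λ { _ (N , refl) → WF-pathFormula 𝒞 N })
                               (2 , λ { _ (N , refl) → pathFormula-bdtw≤2 𝒞 N }) =
  window⇒¬DepthLe k (pathFormula-window 𝒞 k) (depth≤k _ (windowLength k , refl))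

¬bdtw-dominates-depth : ∀ 𝒞 → ¬ Dominates (BdtwLe 𝒞) (DepthLe 𝒞)
¬bdtw-dominates-depth 𝒞 dominates
  with k , bdtw≤k ← dominates (λ F → ∃ λ n → F ≡ gadgetFormula 𝒞 n)
                              (λ { _ (n , refl) → WF-gadgetFormula 𝒞 n })
                              (2 , λ { _ (n , refl) → GadgetDepth.depth≤2 𝒞 n }) =
  gadgetFormula-¬bdtw 𝒞 k (bdtw≤k _ (2 + k , refl))

mainTheorem15 : ∀ (𝒞 : BaseClass) → DominationOrthogonal (DepthLe 𝒞) (BdtwLe 𝒞)
mainTheorem15 𝒞 = ¬depth-dominates-bdtw 𝒞 , ¬bdtw-dominates-depth 𝒞
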